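{- For every integer $n\ge 1$, $L_p(n,2)=2^{n-1}+n-2$, where $L_p(n,2)$ is the maximum, over all unavoidable sets $S$ of patterns of length $n$ over the alphabet $\{1,2\}$, of the maximal length of an $S$-free $n$-pattern word over $\{1,2\}$.
   Context: Let $[m]=\{1,\ldots,m\}$ with its natural order; here $m=2$. A word is a finite sequence of letters; a subword means a block of consecutive letters. A pattern is a nonempty word which, for some $k\ge1$, contains each of the letters $1,\ldots,k$ at least once and no other letters. An $n$-pattern word over $[m]$ is a word over $[m]$ in which every subword of length $n$ is a pattern. For a set $S$ of patterns of length $n$ over $[m]$, a word is $S$-free if it contains no element of $S$ as a subword; $S$ is unavoidable if there is a natural number $k$ such that every $S$-free $n$-pattern word over $[m]$ has length less than $k$ (so for unavoidable $S$ the maximal length of an $S$-free $n$-pattern word is finite). -}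

module Defs where

open import Data.Nat using (ℕ; zero; suc; _+_; _∸_; _^_; _≤_; _<_)
open import Data.Fin using (Fin; toℕ)
open import Data.List using (List; length; _++_)
open import Data.List.Membership.Propositional using (_∈_)
open import Data.List.Relation.Unary.All using (All)
open import Data.Product using (Σ; ∃; _×_; _,_)
open import Relation.Binary.PropositionalEquality using (_≡_)
open import Relation.Nullary using (¬_)

-- Alphabet [m] = {1,…,m}; the letter i+1 is represented by (i : Fin m),
-- so the natural order is the order of Fin m and letter value = toℕ i + 1.
Word : ℕ → Set
Word m = List (Fin m)

IsPattern : ∀ {m} → Word m → Set
IsPattern {m} w =
  (0 < length w) ×
  Σ ℕ (λ k → (1 ≤ k) ×
     ((j : ℕ) → j < k → Σ (Fin m) (λ a → (toℕ a ≡ j) × (a ∈ w))) ×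
     All (λ a → toℕ a < k) w)

Subword : ∀ {m} → Word m → Word m → Set
Subword {m} u w = Σ (Word m) (λ x → Σ (Word m) (λ y → w ≡ x ++ u ++ y))

NPatternWord : ∀ {m} → ℕ → Word m → Set
NPatternWord {m} n w = (u : Word m) → Subword u w → length u ≡ n → IsPattern u

PatternSet : ∀ {m} → ℕ → List (Word m) → Set
PatternSet n S = All (λ p → IsPattern p × (length p ≡ n)) S

Free : ∀ {m} → List (Word m) → Word m → Set
Free S w = ∀ p → p ∈ S → ¬ Subword p w

Unavoidable : ∀ {m} → ℕ → List (Word m) → Set
Unavoidable {m} n S =
  Σ ℕ (λ k → (w : Word m) → NPatternWord n w → Free S w → length w < k)

LpEquals : ℕ → ℕ → ℕ → Set
LpEquals n m v =
  ((S : List (Word m)) → PatternSet n S → Unavoidable n S →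
     (w : Word m) → NPatternWord n w → Free S w → length w ≤ v)
  ×
  Σ (List (Word m)) (λ S → PatternSet n S × Unavoidable n S ×
     Σ (Word m) (λ w → NPatternWord n w × Free S w × (length w ≡ v)))

{-# OPTIONS --safe #-}
-- Upper bound: in an n-pattern word of length at least 2^(n-1) + n - 1 two of the first
-- 2^(n-1) + 1 windows of length n - 1 coincide, so the word is periodic on a stretch containing
-- both; repeating that period gives arbitrarily long words all of whose length-n subwords occur
-- in the original word, so they are again S-free n-pattern words, contradicting unavoidability.
-- Lower bound: let w be a linear de Bruijn word of order n - 1 (of length 2^(n-1) + n - 2) and
-- S the set of patterns of length n missing from w. A block of n letters 2 in w would repeat a
-- window of length n - 1, so w is an S-free n-pattern word. Every length-n subword of an S-free
-- n-pattern word v occurs in w, and as w repeats no window of length n - 1, consecutive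
-- subwords of v occur at consecutive positions of w; hence v is no longer than w.
-- De Bruijn cycles of all orders come from Lempel's lift: if c is a cycle of order k with an
-- even number of ones, its running xor a and the shifted complement of a carry the 2^(k+1)
-- windows of order k + 1 between them, and splicing the two where c has a block of k ones gives
-- a cycle of order k + 1.
module Submission where

open import Defs
open import Data.Bool using (Bool; true; false; not; _xor_)
open import Data.Bool.Properties
  using ( not-involutive; not-injective; not-¬; not-distribʳ-xor
        ; xor-same; xor-assoc; xor-comm; xor-identityʳ; xor-annihilates-not)
open import Data.Nat
open import Data.Nat.Properties
open import Data.Nat.DivMod
open import Data.Nat.Induction using (<-rec)
open import Data.Nat.Tactic.RingSolver using (solve-∀)
open import Data.Fin using (Fin; zero; suc; toℕ; combine)
import Data.Fin as Fin
open import Data.Fin.Properties using (combine-injective; pigeonhole; toℕ<n; 2↔Bool)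
open import Data.List using (List; []; _∷_; length; _++_; take; drop; applyUpTo; filter; allFin; cartesianProductWith)
open import Data.List.Properties using (length-++; take++drop≡id; length-applyUpTo)
open import Data.List.Membership.Propositional using (_∈_; _∉_)
open import Data.List.Membership.Propositional.Properties
  using (∈-length; ∈-filter⁺; ∈-filter⁻; ∈-allFin; ∈-cartesianProductWith⁺; ∈-cartesianProductWith⁻)
open import Data.List.Membership.DecPropositional (Fin._≟_ {2}) using (_∈?_)
open import Data.List.Relation.Unary.Any using (here; there)
import Data.List.Relation.Unary.All as All
open import Data.List.Relation.Binary.Infix.Heterogeneous using (Infix; MkView; toView; fromView)
open import Data.List.Relation.Binary.Infix.Heterogeneous.Properties using (infix?)
open import Data.List.Relation.Binary.Pointwise using (Pointwise-≡⇒≡; ≡⇒Pointwise-≡)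
open import Data.Product using (Σ; ∃; ∃₂; _×_; _,_; proj₁; proj₂; map₂)
open import Data.Empty using (⊥-elim)
open import Function using (_∘_; const)
open import Function.Bundles using (Injection)
open import Function.Properties.Inverse using (↔⇒↣; ↔-sym)
open import Relation.Nullary using (Dec; yes; no; ¬_; contradiction)
open import Relation.Nullary.Decidable using (map′; _×-dec_; ¬?)
open import Relation.Binary.PropositionalEquality

private variable
  A : Set
  q : ℕ

record EqWindow (k : ℕ) (f : ℕ → A) (i : ℕ) (g : ℕ → A) (j : ℕ) : Set where
  constructor eqWindow
  field agree : ∀ s → s < k → f (i + s) ≡ g (j + s)
open EqWindow

Run : ℕ → (ℕ → A) → A → ℕ → Set
Run k f v p = EqWindow k f p (const v) 0

Periodic : ℕ → (ℕ → A) → Set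
Periodic N f = ∀ t → f (t + N) ≡ f t

record DeBruijnCycle (N k : ℕ) (f : ℕ → A) : Set where
  field
    periodic : Periodic N f
    distinct : ∀ i j → i < N → j < N → EqWindow k f i f j → i ≡ j

module _ {k : ℕ} {f g : ℕ → A} where

  EqWindow-sym : ∀ {i j} → EqWindow k f i g j → EqWindow k g j f i
  EqWindow-sym w = eqWindow λ s s<k → sym (agree w s s<k)

  EqWindow-trans : ∀ {h i j l} → EqWindow k f i g j → EqWindow k g j h l → EqWindow k f i h l
  EqWindow-trans v w = eqWindow λ s s<k → trans (agree v s s<k) (agree w s s<k)

module _ {k : ℕ} {f g : ℕ → A} {i j : ℕ} (w : EqWindow (suc k) f i g j) where

  EqWindow-init : EqWindow k f i g j
  EqWindow-init = eqWindow λ s s<k → agree w s (m<n⇒m<1+n s<k)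

  EqWindow-tail : EqWindow k f (suc i) g (suc j)
  EqWindow-tail = eqWindow λ s s<k → subst₂ (λ x y → f x ≡ g y) (+-suc i s) (+-suc j s) (agree w (suc s) (s≤s s<k))

module _ {N : ℕ} .{{_ : NonZero N}} where

  [m%n+k]%n≡[m+k]%n : ∀ m k → (m % N + k) % N ≡ (m + k) % N
  [m%n+k]%n≡[m+k]%n m k = begin
    (m % N + k) % N          ≡⟨ %-distribˡ-+ (m % N) k N ⟩
    (m % N % N + k % N) % N  ≡⟨ cong (λ r → (r + k % N) % N) (m%n%n≡m%n m N) ⟩
    (m % N + k % N) % N      ≡⟨ %-distribˡ-+ m k N ⟨
    (m + k) % N              ∎
    where open ≡-Reasoning

  +-cancelˡ-% : ∀ P x y → (P + x) % N ≡ (P + y) % N → x % N ≡ y % N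
  +-cancelˡ-% P x y eq = trans (unshift x) (trans (cong (λ r → (r + P * pred N) % N) eq) (sym (unshift y)))
    where
    unshift : ∀ z → z % N ≡ ((P + z) % N + P * pred N) % N
    unshift z = begin
      z % N                            ≡⟨ [m+kn]%n≡m%n z P N ⟨
      (z + P * N) % N                  ≡⟨ cong (λ n → (z + P * n) % N) (suc-pred N) ⟨
      (z + P * suc (pred N)) % N       ≡⟨ cong (_% N) (shuffle z P (pred N)) ⟩
      (P + z + P * pred N) % N         ≡⟨ [m%n+k]%n≡[m+k]%n (P + z) (P * pred N) ⟨
      ((P + z) % N + P * pred N) % N   ∎
      where
      open ≡-Reasoning
      shuffle : ∀ z P n → z + P * suc n ≡ P + z + P * n
      shuffle = solve-∀

module _ {N : ℕ} {f : ℕ → A} (per : Periodic N f) where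

  periodic-+* : ∀ x q → f (x + q * N) ≡ f x
  periodic-+* x zero = cong f (+-identityʳ x)
  periodic-+* x (suc q) = begin
    f (x + (N + q * N))  ≡⟨ cong f (+-assoc-comm x N (q * N)) ⟩
    f (x + q * N + N)    ≡⟨ per (x + q * N) ⟩
    f (x + q * N)        ≡⟨ periodic-+* x q ⟩
    f x                  ∎
    where
    open ≡-Reasoning
    +-assoc-comm : ∀ x y z → x + (y + z) ≡ x + z + y
    +-assoc-comm = solve-∀

  module _ .{{_ : NonZero N}} where

    periodic-% : ∀ x → f x ≡ f (x % N)
    periodic-% x = trans (cong f (m≡m%n+[m/n]*n x N)) (periodic-+* (x % N) (x / N))

    window-% : ∀ k x → EqWindow k f (x % N) f x
    window-% k x = eqWindow λ s _ → begin
      f (x % N + s)        ≡⟨ periodic-% (x % N + s) ⟩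
      f ((x % N + s) % N)  ≡⟨ cong f ([m%n+k]%n≡[m+k]%n x s) ⟩
      f ((x + s) % N)      ≡⟨ periodic-% (x + s) ⟨
      f (x + s)            ∎
      where open ≡-Reasoning

    reachable : ∀ x y → ∃ λ q → ∀ t → f (x + (q + t)) ≡ f (y + t)
    reachable x y = y + pred N * x , λ t → trans (cong f (position t)) (periodic-+* (y + t) x)
      where
      shuffle : ∀ x y t n → x + (y + n * x + t) ≡ y + t + x * suc n
      shuffle = solve-∀
      position : ∀ t → x + (y + pred N * x + t) ≡ y + t + x * N
      position t = trans (shuffle x y t (pred N)) (cong (λ n → y + t + x * n) (suc-pred N))

<-%-injective : ∀ {N i j} .{{_ : NonZero N}} → i < N → j < N → i % N ≡ j % N → i ≡ j
<-%-injective i<N j<N eq = trans (sym (m<n⇒m%n≡m i<N)) (trans eq (m<n⇒m%n≡m j<N))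

module _ {N k : ℕ} .{{_ : NonZero N}} {f : ℕ → A} (C : DeBruijnCycle N k f) where
  open DeBruijnCycle C

  locate : ∀ i j → EqWindow k f i f j → i % N ≡ j % N
  locate i j w = distinct (i % N) (j % N) (m%n<n i N) (m%n<n j N)
    (EqWindow-trans (window-% periodic k i) (EqWindow-trans w (EqWindow-sym (window-% periodic k j))))

  rotate : ∀ P → DeBruijnCycle N k (λ t → f (P + t))
  rotate P = record
    { periodic = λ t → trans (cong f (sym (+-assoc P t N))) (periodic (P + t))
    ; distinct = λ i j i<N j<N w → <-%-injective i<N j<N
        (+-cancelˡ-% P i j (locate (P + i) (P + j) (eqWindow λ s s<k → begin
          f (P + i + s)    ≡⟨ cong f (+-assoc P i s) ⟩
          f (P + (i + s))  ≡⟨ agree w s s<k ⟩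
          f (P + (j + s))  ≡⟨ cong f (+-assoc P j s) ⟨
          f (P + j + s)    ∎)))
    }
    where open ≡-Reasoning

data Split (N : ℕ) : ℕ → Set where
  below : ∀ {x} → x < N → Split N x
  above : ∀ u → Split N (N + u)

split : ∀ N x → Split N x
split N x with x <? N
... | yes x<N = below x<N
... | no x≮N = subst (Split N) (m+[n∸m]≡n (≮⇒≥ x≮N)) (above (x ∸ N))

-- Derivative and running xor of binary sequences

Δ : (ℕ → Bool) → ℕ → Bool
Δ g t = g t xor g (suc t)

∫ : (ℕ → Bool) → ℕ → Bool
∫ c zero = false
∫ c (suc t) = ∫ c t xor c t

xor-cancelˡ : ∀ x {y z} → x xor y ≡ x xor z → y ≡ z
xor-cancelˡ false eq = eq
xor-cancelˡ true eq = not-injective eq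

xor-not-comm : ∀ x y z → (x xor y) xor not z ≡ (x xor z) xor (y xor true)
xor-not-comm false false false = refl
xor-not-comm false false true = refl
xor-not-comm false true false = refl
xor-not-comm false true true = refl
xor-not-comm true false false = refl
xor-not-comm true false true = refl
xor-not-comm true true false = refl
xor-not-comm true true true = refl

Δ-∫ : ∀ c t → Δ (∫ c) t ≡ c t
Δ-∫ c t = trans (sym (xor-assoc (∫ c t) (∫ c t) (c t))) (cong (_xor c t) (xor-same (∫ c t)))

Δ-not : ∀ g t → Δ (not ∘ g) t ≡ Δ g t
Δ-not g t = xor-annihilates-not (g t) (g (suc t))

Δ-window : ∀ {k g h x y} → EqWindow (suc k) g x h y → EqWindow k (Δ g) x (Δ h) y
Δ-window w = eqWindow λ s s<k → cong₂ _xor_ (agree (EqWindow-init w) s s<k) (agree (EqWindow-tail w) s s<k)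

∫-cong : ∀ {g h} n → (∀ t → t < n → g t ≡ h t) → ∫ g n ≡ ∫ h n
∫-cong zero _ = refl
∫-cong (suc n) eq = cong₂ _xor_ (∫-cong n (λ t t<n → eq t (m<n⇒m<1+n t<n))) (eq n (n<1+n n))

∫-+ : ∀ g m n → ∫ g (m + n) ≡ ∫ g m xor ∫ (λ t → g (m + t)) n
∫-+ g m zero = trans (cong (∫ g) (+-identityʳ m)) (sym (xor-identityʳ (∫ g m)))
∫-+ g m (suc n) = begin
  ∫ g (m + suc n)                                        ≡⟨ cong (∫ g) (+-suc m n) ⟩
  ∫ g (m + n) xor g (m + n)                              ≡⟨ cong (_xor g (m + n)) (∫-+ g m n) ⟩
  (∫ g m xor ∫ (λ t → g (m + t)) n) xor g (m + n)        ≡⟨ xor-assoc (∫ g m) _ _ ⟩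
  ∫ g m xor ∫ (λ t → g (m + t)) (suc n)                  ∎
  where open ≡-Reasoning

∫-not : ∀ g n → ∫ (not ∘ g) n ≡ ∫ g n xor ∫ (const true) n
∫-not g zero = refl
∫-not g (suc n) = trans (cong (_xor not (g n)) (∫-not g n)) (xor-not-comm (∫ g n) _ (g n))

∫-true-+-same : ∀ n → ∫ (const true) (n + n) ≡ false
∫-true-+-same n = trans (∫-+ (const true) n n) (xor-same (∫ (const true) n))

module _ {N : ℕ} {g : ℕ → Bool} (per : Periodic N g) where

  ∫-from-period : ∀ t → ∫ g (N + t) ≡ ∫ g N xor ∫ g t
  ∫-from-period t = trans (∫-+ g N t)
    (cong (∫ g N xor_) (∫-cong t (λ s _ → trans (cong g (+-comm N s)) (per s))))

  ∫-periodic : ∫ g N ≡ false → Periodic N (∫ g)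
  ∫-periodic even t = begin
    ∫ g (t + N)          ≡⟨ cong (∫ g) (+-comm t N) ⟩
    ∫ g (N + t)          ≡⟨ ∫-from-period t ⟩
    ∫ g N xor ∫ g t      ≡⟨ cong (_xor ∫ g t) even ⟩
    ∫ g t                ∎
    where open ≡-Reasoning

  ∫-rotate : ∀ x → ∫ (λ t → g (x + t)) N ≡ ∫ g N
  ∫-rotate x = xor-cancelˡ (∫ g x) (begin
    ∫ g x xor ∫ (λ t → g (x + t)) N  ≡⟨ ∫-+ g x N ⟨
    ∫ g (x + N)                      ≡⟨ cong (∫ g) (+-comm x N) ⟩
    ∫ g (N + x)                      ≡⟨ ∫-from-period x ⟩
    ∫ g N xor ∫ g x                  ≡⟨ xor-comm (∫ g N) (∫ g x) ⟩
    ∫ g x xor ∫ g N                  ∎)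
    where open ≡-Reasoning

∫-run : ∀ {k c p} → Run k c false p → Run (suc k) (∫ c) (∫ c p) p
∫-run {c = c} {p} r = eqWindow constant
  where
  constant : ∀ s → s < suc _ → ∫ c (p + s) ≡ ∫ c p
  constant zero _ = cong (∫ c) (+-identityʳ p)
  constant (suc s) (s≤s s<k) = begin
    ∫ c (p + suc s)              ≡⟨ cong (∫ c) (+-suc p s) ⟩
    ∫ c (p + s) xor c (p + s)    ≡⟨ cong (∫ c (p + s) xor_) (agree r s s<k) ⟩
    ∫ c (p + s) xor false        ≡⟨ xor-identityʳ _ ⟩
    ∫ c (p + s)                  ≡⟨ constant s (m<n⇒m<1+n s<k) ⟩
    ∫ c p                        ∎
    where open ≡-Reasoning

-- Lempel's lift of de Bruijn cycles

alternate : ℕ → A → A → A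
alternate zero x y = x
alternate (suc q) x y = alternate q y x

alternate-preserves : ∀ (P : A → Set) q {x y} → P x → P y → P (alternate q x y)
alternate-preserves P zero px py = px
alternate-preserves P (suc q) px py = alternate-preserves P q py px

module Splice {N : ℕ} .{{_ : NonZero N}} where

  splice : (ℕ → A) → (ℕ → A) → ℕ → A
  splice g h t = alternate (t / N) g h t

  [n+m]/n≡1+m/n : ∀ m → (N + m) / N ≡ suc (m / N)
  [n+m]/n≡1+m/n m = trans (m/n≡1+[m∸n]/n (m≤m+n N m)) (cong (λ x → suc (x / N)) (m+n∸m≡n N m))

  splice-below : ∀ {g h : ℕ → A} {t} → t < N → splice g h t ≡ g t
  splice-below {g = g} {h} {t} t<N = cong (λ q → alternate q g h t) (m<n⇒m/n≡0 t<N)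

  splice-shift : ∀ {g h : ℕ → A} → Periodic N g → Periodic N h → ∀ t → splice g h (N + t) ≡ splice h g t
  splice-shift {g = g} {h} g-per h-per t = begin
    alternate ((N + t) / N) g h (N + t)  ≡⟨ cong (λ q → alternate q g h (N + t)) ([n+m]/n≡1+m/n t) ⟩
    alternate (t / N) h g (N + t)        ≡⟨ cong (alternate (t / N) h g) (+-comm N t) ⟩
    alternate (t / N) h g (t + N)        ≡⟨ alternate-preserves (Periodic N) (t / N) h-per g-per t ⟩
    alternate (t / N) h g t              ∎
    where open ≡-Reasoning

  splice-periodic : ∀ {g h : ℕ → A} → Periodic N g → Periodic N h → Periodic (N + N) (splice g h)
  splice-periodic {g = g} {h} g-per h-per t = begin
    splice g h (t + (N + N))  ≡⟨ cong (splice g h) (+-comm t (N + N)) ⟩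
    splice g h (N + N + t)    ≡⟨ cong (splice g h) (+-assoc N N t) ⟩
    splice g h (N + (N + t))  ≡⟨ splice-shift g-per h-per (N + t) ⟩
    splice h g (N + t)        ≡⟨ splice-shift h-per g-per t ⟩
    splice g h t              ∎
    where open ≡-Reasoning

  module _ {K : ℕ} (K≤N : K ≤ N) where

    splice-left : ∀ {g h : ℕ → A} → Periodic N g → Periodic N h → (∀ u → u < K → g u ≡ h u) →
                  ∀ {x} → x < N + K → splice g h x ≡ g x
    splice-left {g = g} {h} g-per h-per g≡h {x} x<N+K with split N x
    ... | below x<N = splice-below x<N
    ... | above u = begin
      splice g h (N + u)  ≡⟨ splice-shift g-per h-per u ⟩
      splice h g u        ≡⟨ splice-below (<-≤-trans u<K K≤N) ⟩
      h u                 ≡⟨ g≡h u u<K ⟨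
      g u                 ≡⟨ g-per u ⟨
      g (u + N)           ≡⟨ cong g (+-comm u N) ⟩
      g (N + u)           ∎
      where
      open ≡-Reasoning
      u<K : u < K
      u<K = +-cancelˡ-< N u K x<N+K

    module _ {g h : ℕ → A} (g-per : Periodic N g) (h-per : Periodic N h) (g≡h : ∀ u → u < K → g u ≡ h u) where

      splice-window-left : ∀ {i} → i < N → EqWindow (suc K) (splice g h) i g i
      splice-window-left i<N = eqWindow λ s s≤K →
        splice-left g-per h-per g≡h (+-mono-<-≤ i<N (≤-pred s≤K))

      splice-window-right : ∀ {i} → i < N → EqWindow (suc K) (splice g h) (N + i) h i
      splice-window-right {i} i<N = eqWindow λ s s≤K → begin
        splice g h (N + i + s)    ≡⟨ cong (splice g h) (+-assoc N i s) ⟩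
        splice g h (N + (i + s))  ≡⟨ splice-shift g-per h-per (i + s) ⟩
        splice h g (i + s)        ≡⟨ splice-left h-per g-per (λ u u<K → sym (g≡h u u<K))
                                                   (+-mono-<-≤ i<N (≤-pred s≤K)) ⟩
        h (i + s)                 ∎
        where open ≡-Reasoning

both-runs : ∀ {k f v x y} → Run k f v x → Run k f (not v) y → ∃₂ λ x y → Run k f true x × Run k f false y
both-runs {v = true} {x} {y} r r′ = x , y , r , r′
both-runs {v = false} {x} {y} r r′ = y , x , r′ , r

n<2^n : ∀ n → n < 2 ^ n
n<2^n zero = s≤s z≤n
n<2^n (suc n) = +-mono-≤ (m^n>0 2 n) (≤-trans (n<2^n n) (m≤m+n (2 ^ n) 0))

-- The block of k ones at 0 is where Lempel's lift splices, the block of k zeros yields the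
-- blocks of k + 1 ones and zeros of the lifted cycle, and evenness makes ∫ c periodic.
record LiftableCycle (k : ℕ) (c : ℕ → Bool) : Set where
  field
    cycle : DeBruijnCycle (2 ^ k) k c
    ones  : Run k c true 0
    zeros : ∃ (Run k c false)
    even  : ∫ c (2 ^ k) ≡ false

module Lift {k : ℕ} {c : ℕ → Bool} (L : LiftableCycle (suc k) c) where
  open LiftableCycle L
  open DeBruijnCycle cycle

  K N M : ℕ
  K = suc k
  N = 2 ^ K
  M = 2 ^ suc K

  instance
    N≢0 : NonZero N
    N≢0 = m^n≢0 2 K
    M≢0 : NonZero M
    M≢0 = m^n≢0 2 (suc K)

  open Splice {N = N}

  M≡N+N : M ≡ N + N
  M≡N+N = cong (N +_) (+-identityʳ N)

  a b d : ℕ → Bool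
  a = ∫ c
  b t = not (a (suc t))
  d = splice a b

  a-periodic : Periodic N a
  a-periodic = ∫-periodic periodic even

  b-periodic : Periodic N b
  b-periodic t = cong not (a-periodic (suc t))

  a≡b : ∀ u → u < K → a u ≡ b u
  a≡b u u<K = sym (begin
    not (a u xor c u)            ≡⟨ cong (λ x → not (a u xor x)) (agree ones u u<K) ⟩
    not (a u xor true)           ≡⟨ cong not (not-distribʳ-xor (a u) false) ⟨
    not (not (a u xor false))    ≡⟨ not-involutive _ ⟩
    a u xor false                ≡⟨ xor-identityʳ (a u) ⟩
    a u                          ∎)
    where open ≡-Reasoning

  d-periodic : Periodic (N + N) d
  d-periodic = splice-periodic a-periodic b-periodic

  d-window-a : ∀ {i} → i < N → EqWindow (suc K) d i a i
  d-window-a = splice-window-left (<⇒≤ (n<2^n K)) a-periodic b-periodic a≡b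

  d-window-b : ∀ {i} → i < N → EqWindow (suc K) d (N + i) b i
  d-window-b = splice-window-right (<⇒≤ (n<2^n K)) a-periodic b-periodic a≡b

  window-Δ : ∀ {g x y} → (∀ t → Δ g t ≡ c t) → EqWindow (suc K) a x g y → EqWindow K c x c y
  window-Δ {x = x} {y} Δg≡c w = eqWindow λ s s<K →
    trans (sym (Δ-∫ c (x + s))) (trans (agree (Δ-window w) s s<K) (Δg≡c (y + s)))

  a-locate : ∀ {x y} → EqWindow (suc K) a x a y → x % N ≡ y % N
  a-locate {x} {y} w = locate cycle x y (window-Δ (Δ-∫ c) w)

  b-locate : ∀ {x y} → EqWindow (suc K) b x b y → x % N ≡ y % N
  b-locate {x} {y} w = +-cancelˡ-% 1 x y (a-locate (eqWindow λ s s<K → not-injective (agree w s s<K)))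

  a-not-complement : ∀ {x y} → ¬ EqWindow (suc K) a x (not ∘ a) y
  a-not-complement {x} {y} w = not-¬ a[x]≡a[y] a[x]≡not-a[y]
    where
    x≡y : x % N ≡ y % N
    x≡y = locate cycle x y (window-Δ (λ t → trans (Δ-not a t) (Δ-∫ c t)) w)
    a[x]≡a[y] : a x ≡ a y
    a[x]≡a[y] = trans (periodic-% a-periodic x) (trans (cong a x≡y) (sym (periodic-% a-periodic y)))
    a[x]≡not-a[y] : a x ≡ not (a y)
    a[x]≡not-a[y] = subst₂ (λ u v → a u ≡ not (a v)) (+-identityʳ x) (+-identityʳ y) (agree w 0 z<s)

  a-not-b : ∀ {x y} → ¬ EqWindow (suc K) a x b y
  a-not-b {x} {y} w = a-not-complement {x} {suc y} (eqWindow (agree w))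

  d-distinct : ∀ i j → i < N + N → j < N + N → EqWindow (suc K) d i d j → i ≡ j
  d-distinct i j i<M j<M w with split N i | split N j
  ... | below i<N | below j<N = <-%-injective i<N j<N
    (a-locate (EqWindow-trans (EqWindow-sym (d-window-a i<N)) (EqWindow-trans w (d-window-a j<N))))
  ... | below i<N | above v = ⊥-elim (a-not-b
    (EqWindow-trans (EqWindow-sym (d-window-a i<N)) (EqWindow-trans w (d-window-b (+-cancelˡ-< N v N j<M)))))
  ... | above u | below j<N = ⊥-elim (a-not-b
    (EqWindow-trans (EqWindow-sym (d-window-a j<N)) (EqWindow-trans (EqWindow-sym w) (d-window-b (+-cancelˡ-< N u N i<M)))))
  ... | above u | above v = cong (N +_) (<-%-injective u<N v<N
    (b-locate (EqWindow-trans (EqWindow-sym (d-window-b u<N)) (EqWindow-trans w (d-window-b v<N)))))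
    where
    u<N : u < N
    u<N = +-cancelˡ-< N u N i<M
    v<N : v < N
    v<N = +-cancelˡ-< N v N j<M

  d-cycle : DeBruijnCycle M (suc K) d
  d-cycle = subst (λ P → DeBruijnCycle P (suc K) d) (sym M≡N+N)
                  (record { periodic = d-periodic ; distinct = d-distinct })

  d-second-half : ∀ t → t < N → d (N + t) ≡ b t
  d-second-half t t<N = trans (splice-shift a-periodic b-periodic t) (splice-below t<N)

  d-even : ∫ d M ≡ false
  d-even = begin
    ∫ d M                                                   ≡⟨ cong (∫ d) M≡N+N ⟩
    ∫ d (N + N)                                             ≡⟨ ∫-+ d N N ⟩
    ∫ d N xor ∫ (λ t → d (N + t)) N                         ≡⟨ cong₂ _xor_ (∫-cong N λ _ → splice-below)
                                                                             (∫-cong N d-second-half) ⟩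
    ∫ a N xor ∫ b N                                         ≡⟨ cong (∫ a N xor_) (∫-not (λ t → a (suc t)) N) ⟩
    ∫ a N xor (∫ (λ t → a (1 + t)) N xor ∫ (const true) N)  ≡⟨ cong₂ (λ x y → ∫ a N xor (x xor y))
                                                                      (∫-rotate a-periodic 1) N-even ⟩
    ∫ a N xor (∫ a N xor false)                             ≡⟨ cong (∫ a N xor_) (xor-identityʳ (∫ a N)) ⟩
    ∫ a N xor ∫ a N                                         ≡⟨ xor-same (∫ a N) ⟩
    false                                                   ∎
    where
    open ≡-Reasoning
    N-even : ∫ (const true) N ≡ false
    N-even = trans (cong (∫ (const true)) (cong (2 ^ k +_) (+-identityʳ (2 ^ k)))) (∫-true-+-same (2 ^ k))

  d-runs : ∃₂ λ x y → Run (suc K) d true x × Run (suc K) d false y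
  d-runs with p , zeros-at-p ← zeros =
    runs (p % N) (m%n<n p N) (EqWindow-trans (window-% periodic K p) zeros-at-p)
    where
    runs : ∀ p → p < N → Run K c false p → ∃₂ λ x y → Run (suc K) d true x × Run (suc K) d false y
    runs zero _ r = ⊥-elim (not-¬ (agree ones 0 z<s) (agree r 0 z<s))
    runs (suc q) p<N r = both-runs (EqWindow-trans (d-window-a p<N) a-run) (EqWindow-trans (d-window-b (<⇒≤ p<N)) b-run)
      where
      a-run : Run (suc K) a (a (suc q)) (suc q)
      a-run = ∫-run r
      b-run : Run (suc K) b (not (a (suc q))) q
      b-run = eqWindow λ s s≤K → cong not (agree a-run s s≤K)

  lifted : ∃ (LiftableCycle (suc K))
  lifted with x , y , ones′ , zeros′ ← d-runs
         with q , reach ← reachable (DeBruijnCycle.periodic d-cycle) x y = (λ t → d (x + t)) , record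
    { cycle = rotate d-cycle x
    ; ones = eqWindow (agree ones′)
    ; zeros = q , eqWindow λ s s≤K → trans (reach s) (agree zeros′ s s≤K)
    ; even = trans (∫-rotate (DeBruijnCycle.periodic d-cycle) x) d-even
    }

c₂ c₄ : ℕ → Bool
c₂ t = t % 2 ≡ᵇ 0
c₄ t = t % 4 <ᵇ 2

c₂-cycle : DeBruijnCycle 2 1 c₂
c₂-cycle = record
  { periodic = λ t → cong (_≡ᵇ 0) ([m+n]%n≡m%n t 2)
  ; distinct = λ i j i<2 j<2 w → trans (sym (decode i<2)) (trans (cong code (agree w 0 z<s)) (decode j<2))
  }
  where
  code : Bool → ℕ
  code true = 0
  code false = 1
  decode : ∀ {i} → i < 2 → code (c₂ (i + 0)) ≡ i
  decode {0} _ = refl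
  decode {1} _ = refl
  decode {suc (suc _)} (s≤s (s≤s ()))

c₄-liftable : LiftableCycle 2 c₄
c₄-liftable = record
  { cycle = record
    { periodic = λ t → cong (_<ᵇ 2) ([m+n]%n≡m%n t 4)
    ; distinct = λ i j i<4 j<4 w →
        trans (sym (decode i<4)) (trans (cong₂ code (agree w 0 z<s) (agree w 1 (s<s z<s))) (decode j<4))
    }
  ; ones = eqWindow λ { 0 _ → refl ; 1 _ → refl ; (suc (suc _)) (s≤s (s≤s ())) }
  ; zeros = 2 , eqWindow λ { 0 _ → refl ; 1 _ → refl ; (suc (suc _)) (s≤s (s≤s ())) }
  ; even = refl
  }
  where
  code : Bool → Bool → ℕ
  code true true = 0
  code true false = 1
  code false false = 2
  code false true = 3
  decode : ∀ {i} → i < 4 → code (c₄ (i + 0)) (c₄ (i + 1)) ≡ i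
  decode {0} _ = refl
  decode {1} _ = refl
  decode {2} _ = refl
  decode {3} _ = refl
  decode {suc (suc (suc (suc _)))} (s≤s (s≤s (s≤s (s≤s ()))))

liftable-cycle : ∀ k → ∃ (LiftableCycle (2 + k))
liftable-cycle zero = c₄ , c₄-liftable
liftable-cycle (suc k) = Lift.lifted (proj₂ (liftable-cycle k))

de-Bruijn-cycle : ∀ k → ∃ λ (f : ℕ → Bool) → DeBruijnCycle (2 ^ k) k f
de-Bruijn-cycle 0 = const true , record
  { periodic = λ _ → refl
  ; distinct = λ { 0 0 _ _ _ → refl ; (suc _) _ (s≤s ()) _ _ ; _ (suc _) _ (s≤s ()) _ }
  }
de-Bruijn-cycle 1 = c₂ , c₂-cycle
de-Bruijn-cycle (suc (suc k)) = map₂ LiftableCycle.cycle (liftable-cycle k)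

-- Positions past the end read as the letter 1; all uses stay within bounds.
at : Word (suc q) → ℕ → Fin (suc q)
at [] _ = zero
at (x ∷ _) zero = x
at (_ ∷ w) (suc i) = at w i

window : ℕ → ℕ → List A → List A
window i n w = take n (drop i w)

length-window : ∀ i n (w : List A) → i + n ≤ length w → length (window i n w) ≡ n
length-window zero zero _ _ = refl
length-window zero (suc n) (x ∷ w) (s≤s le) = cong suc (length-window zero n w le)
length-window (suc i) n (x ∷ w) (s≤s le) = length-window i n w le

at-take : ∀ (w : Word (suc q)) {n r} → r < n → at (take n w) r ≡ at w r
at-take [] {suc n} _ = refl
at-take (x ∷ w) {suc n} {zero} _ = refl
at-take (x ∷ w) {suc n} {suc r} (s≤s r<n) = at-take w r<n

at-window : ∀ (w : Word (suc q)) i {n r} → r < n → at (window i n w) r ≡ at w (i + r)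
at-window w zero = at-take w
at-window [] (suc i) = at-take []
at-window (x ∷ w) (suc i) = at-window w i

at-applyUpTo : ∀ (f : ℕ → Fin (suc q)) {n t} → t < n → at (applyUpTo f n) t ≡ f t
at-applyUpTo f {suc n} {zero} _ = refl
at-applyUpTo f {suc n} {suc t} (s≤s t<n) = at-applyUpTo (λ s → f (suc s)) t<n

at-∈ : ∀ (u : Word (suc q)) {r} → r < length u → at u r ∈ u
at-∈ (x ∷ u) {zero} _ = here refl
at-∈ (x ∷ u) {suc r} (s≤s r<n) = there (at-∈ u r<n)

≡-by-at : ∀ (u v : Word (suc q)) → length u ≡ length v → (∀ r → r < length u → at u r ≡ at v r) → u ≡ v
≡-by-at [] [] _ _ = refl
≡-by-at (x ∷ u) (y ∷ v) eq pointwise =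
  cong₂ _∷_ (pointwise 0 z<s) (≡-by-at u v (suc-injective eq) (λ r r<n → pointwise (suc r) (s≤s r<n)))

window-subword : ∀ {m} i n (w : Word m) → Subword (window i n w) w
window-subword i n w = take i w , drop n (drop i w) ,
  sym (trans (cong (take i w ++_) (take++drop≡id n (drop i w))) (take++drop≡id i w))

subword-at : ∀ {u w : Word (suc q)} → Subword u w →
             ∃ λ i → i + length u ≤ length w × EqWindow (length u) (at u) 0 (at w) i
subword-at {u = u} (x , y , refl) = length x , fits , eqWindow λ r r<n → sym (trans (at-++ʳ x r) (at-++ˡ u r<n))
  where
  fits : length x + length u ≤ length (x ++ u ++ y)
  fits = subst (length x + length u ≤_) (sym (trans (length-++ x) (cong (length x +_) (length-++ u))))
           (+-monoʳ-≤ (length x) (m≤m+n (length u) (length y)))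
  at-++ʳ : ∀ x {z} r → at (x ++ z) (length x + r) ≡ at z r
  at-++ʳ [] r = refl
  at-++ʳ (_ ∷ x) r = at-++ʳ x r
  at-++ˡ : ∀ u {z r} → r < length u → at (u ++ z) r ≡ at u r
  at-++ˡ (_ ∷ u) {r = zero} _ = refl
  at-++ˡ (_ ∷ u) {r = suc r} (s≤s r<n) = at-++ˡ u r<n

subword? : ∀ {m} (u w : Word m) → Dec (Subword u w)
subword? u w = map′ from-infix to-infix (infix? Fin._≟_ u w)
  where
  from-infix : Infix _≡_ u w → Subword u w
  from-infix i with MkView x pw y ← toView i = x , y , cong (λ z → x ++ z ++ y) (sym (Pointwise-≡⇒≡ pw))
  to-infix : Subword u w → Infix _≡_ u w
  to-infix (x , y , refl) = fromView (MkView x (≡⇒Pointwise-≡ refl) y)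

_⊆[_]_ : ∀ {m} → Word m → ℕ → Word m → Set
v ⊆[ n ] w = ∀ u → Subword u v → length u ≡ n → Subword u w

⊆-npattern : ∀ {m n} {v w : Word m} → v ⊆[ n ] w → NPatternWord n w → NPatternWord n v
⊆-npattern v⊆w w-pattern u u⊑v |u| = w-pattern u (v⊆w u u⊑v |u|) |u|

⊆-free : ∀ {m n} {S : List (Word m)} {v w} → PatternSet n S → v ⊆[ n ] w → Free S w → Free S v
⊆-free S-patterns v⊆w w-free p p∈S p⊑v = w-free p p∈S (v⊆w p p⊑v (proj₂ (All.lookup S-patterns p∈S)))

Occurrences : ℕ → Word (suc q) → Word (suc q) → Set
Occurrences n v w = ∀ s → s + n ≤ length v → ∃ λ j → j + n ≤ length w × EqWindow n (at v) s (at w) j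

occurrences⇒⊆ : ∀ {n} {v w : Word (suc q)} → Occurrences n v w → v ⊆[ n ] w
occurrences⇒⊆ {n = n} {v} {w} occ u u⊑v refl
  with i , i-fits , u≡v ← subword-at u⊑v
  with j , j-fits , v≡w ← occ i i-fits =
  subst (λ z → Subword z w) (sym u≡window) (window-subword j n w)
  where
  u≡window : u ≡ window j n w
  u≡window = ≡-by-at u (window j n w) (sym (length-window j n w j-fits))
    λ r r<n → trans (agree (EqWindow-trans u≡v v≡w) r r<n) (sym (at-window w j r<n))

⊆⇒occurrences : ∀ {n} {v w : Word (suc q)} → v ⊆[ n ] w → Occurrences n v w
⊆⇒occurrences {n = n} {v} {w} v⊆w s s-fits
  with j , j-fits , eq ← subword-at (v⊆w (window s n v) (window-subword s n v) (length-window s n v s-fits)) =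
  j , subst (λ l → j + l ≤ length w) |window| j-fits ,
  eqWindow λ r r<n → trans (sym (at-window v s r<n)) (agree eq r (subst (r <_) (sym |window|) r<n))
  where
  |window| : length (window s n v) ≡ n
  |window| = length-window s n v s-fits

-- Upper bound: pumping a repeated window

encode : ∀ n → Word (suc q) → Fin (suc q ^ n)
encode zero _ = zero
encode {q} (suc n) [] = combine {suc q} zero (encode n [])
encode (suc n) (x ∷ u) = combine x (encode n u)

encode-injective : ∀ n (u v : Word (suc q)) → length u ≡ n → length v ≡ n → encode n u ≡ encode n v → u ≡ v
encode-injective zero [] [] _ _ _ = refl
encode-injective (suc n) (x ∷ u) (y ∷ v) |u| |v| eq with combine-injective x (encode n u) y (encode n v) eq
... | x≡y , eq′ = cong₂ _∷_ x≡y (encode-injective n u v (suc-injective |u|) (suc-injective |v|) eq′)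

repeated-window : ∀ {m} (w : Word (suc q)) → suc q ^ m + m ≤ length w →
                  ∃₂ λ i j → i < j × j + m ≤ length w × EqWindow m (at w) i (at w) j
repeated-window {q = q} {m} w long with pigeonhole (n<1+n (suc q ^ m)) (λ x → encode m (window (toℕ x) m w))
... | x , y , x<y , eq = toℕ x , toℕ y , x<y , fits y , eqWindow λ r r<m → begin
  at w (toℕ x + r)              ≡⟨ at-window w (toℕ x) r<m ⟨
  at (window (toℕ x) m w) r     ≡⟨ cong (λ u → at u r) same-window ⟩
  at (window (toℕ y) m w) r     ≡⟨ at-window w (toℕ y) r<m ⟩
  at w (toℕ y + r)              ∎
  where
  open ≡-Reasoning
  fits : ∀ z → toℕ z + m ≤ length w
  fits z = ≤-trans (+-monoˡ-≤ m (≤-pred (toℕ<n z))) long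
  same-window : window (toℕ x) m w ≡ window (toℕ y) m w
  same-window = encode-injective m _ _ (length-window (toℕ x) m w (fits x)) (length-window (toℕ y) m w (fits y)) eq

periodic-prefix : ∀ {p m} .{{_ : NonZero p}} {g : ℕ → A} → (∀ y → y < m → g (y + p) ≡ g y) →
                  ∀ y → y < p + m → g y ≡ g (y % p)
periodic-prefix {p = p} {m} {g} repeats = <-rec _ reduce
  where
  reduce : ∀ y → (∀ {z} → z < y → z < p + m → g z ≡ g (z % p)) → y < p + m → g y ≡ g (y % p)
  reduce y rec y<p+m with split p y
  ... | below y<p = cong g (sym (m<n⇒m%n≡m y<p))
  ... | above u = begin
    g (p + u)          ≡⟨ cong g (+-comm p u) ⟩
    g (u + p)          ≡⟨ repeats u (+-cancelˡ-< p u m y<p+m) ⟩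
    g u                ≡⟨ rec u<p+u (<-≤-trans u<p+u (<⇒≤ y<p+m)) ⟩
    g (u % p)          ≡⟨ cong g ([m+n]%n≡m%n u p) ⟨
    g ((u + p) % p)    ≡⟨ cong (λ z → g (z % p)) (+-comm u p) ⟩
    g ((p + u) % p)    ∎
    where
    open ≡-Reasoning
    u<p+u : u < p + u
    u<p+u = m<n+m u (>-nonZero⁻¹ p)

module Pump (w : Word (suc q)) {i j m : ℕ} (i<j : i < j) (j-fits : j + m ≤ length w)
            (repeat : EqWindow m (at w) i (at w) j) where

  p : ℕ
  p = j ∸ i

  instance
    p≢0 : NonZero p
    p≢0 = >-nonZero (m<n⇒0<n∸m i<j)

  g : ℕ → Fin (suc q)
  g y = at w (i + y)

  g-repeats : ∀ y → y < m → g (y + p) ≡ g y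
  g-repeats y y<m = begin
    at w (i + (y + p))  ≡⟨ cong (at w) (trans (cong (i +_) (+-comm y p)) (sym (+-assoc i p y))) ⟩
    at w (i + p + y)    ≡⟨ cong (λ z → at w (z + y)) (m+[n∸m]≡n (<⇒≤ i<j)) ⟩
    at w (j + y)        ≡⟨ agree repeat y y<m ⟨
    at w (i + y)        ∎
    where open ≡-Reasoning

  pumped : ℕ → Word (suc q)
  pumped L = applyUpTo (λ t → g (t % p)) L

  residue-fits : ∀ s → i + s % p + suc m ≤ length w
  residue-fits s = begin
    i + s % p + suc m    ≡⟨ +-suc (i + s % p) m ⟩
    suc (i + s % p) + m  ≡⟨ cong (_+ m) (+-suc i (s % p)) ⟨
    i + suc (s % p) + m  ≤⟨ +-monoˡ-≤ m (+-monoʳ-≤ i (m%n<n s p)) ⟩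
    i + p + m            ≡⟨ cong (_+ m) (m+[n∸m]≡n (<⇒≤ i<j)) ⟩
    j + m                ≤⟨ j-fits ⟩
    length w             ∎
    where open ≤-Reasoning

  pumped-window : ∀ L s → s + suc m ≤ length (pumped L) → EqWindow (suc m) (at (pumped L)) s (at w) (i + s % p)
  pumped-window L s s-fits = eqWindow λ r r≤m → begin
    at (pumped L) (s + r)      ≡⟨ at-applyUpTo _ (s+r<L r≤m) ⟩
    g ((s + r) % p)            ≡⟨ cong g ([m%n+k]%n≡[m+k]%n s r) ⟨
    g ((s % p + r) % p)        ≡⟨ periodic-prefix g-repeats (s % p + r) (+-mono-<-≤ (m%n<n s p) (≤-pred r≤m)) ⟨
    g (s % p + r)              ≡⟨ cong (at w) (+-assoc i (s % p) r) ⟨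
    at w (i + s % p + r)       ∎
    where
    open ≡-Reasoning
    s+r<L : ∀ {r} → r < suc m → s + r < L
    s+r<L r≤m = <-≤-trans (+-monoʳ-< s r≤m) (subst (s + suc m ≤_) (length-applyUpTo _ L) s-fits)

  pumped-⊆ : ∀ L → pumped L ⊆[ suc m ] w
  pumped-⊆ L = occurrences⇒⊆ λ s s-fits → i + s % p , residue-fits s , pumped-window L s s-fits

unavoidable-bound : ∀ {n} {S : List (Word (suc q))} → PatternSet (suc n) S → Unavoidable (suc n) S →
                    ∀ w → NPatternWord (suc n) w → Free S w → length w < suc q ^ n + n
unavoidable-bound {q = q} {n} S-patterns (K , bounded) w w-pattern w-free with suc q ^ n + n ≤? length w
... | no short = ≰⇒> short
... | yes long with i , j , i<j , j-fits , repeat ← repeated-window w long =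
  contradiction (bounded (pumped K) (⊆-npattern (pumped-⊆ K) w-pattern) (⊆-free S-patterns (pumped-⊆ K) w-free))
                (subst (_≮ K) (sym (length-applyUpTo _ K)) (<-irrefl refl))
  where open Pump w i<j j-fits repeat

-- Lower bound: de Bruijn words

DistinctWindows : ℕ → Word (suc q) → Set
DistinctWindows m w = ∀ i j → i + m ≤ length w → j + m ≤ length w → EqWindow m (at w) i (at w) j → i ≡ j

module _ {m : ℕ} {v w : Word (suc q)} (distinct : DistinctWindows m w) (v⊆w : v ⊆[ suc m ] w) where

  private
    occurrence : Occurrences (suc m) v w
    occurrence = ⊆⇒occurrences v⊆w

    track : ∀ s → s + suc m ≤ length v →
            ∃ λ j → s ≤ j × j + suc m ≤ length w × EqWindow (suc m) (at v) s (at w) j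
    track zero s-fits with j , j-fits , eq ← occurrence 0 s-fits = j , z≤n , j-fits , eq
    track (suc s) s-fits
      with j , s≤j , j-fits , eq ← track s (≤-trans (n≤1+n _) s-fits)
         | j′ , j′-fits , eq′ ← occurrence (suc s) s-fits
      = j′ , subst (suc s ≤_) 1+j≡j′ (s≤s s≤j) , j′-fits , eq′
      where
      1+j≡j′ : suc j ≡ j′
      1+j≡j′ = distinct (suc j) j′ (subst (_≤ length w) (+-suc j m) j-fits)
                                   (≤-trans (+-monoʳ-≤ j′ (n≤1+n m)) j′-fits)
        (EqWindow-trans (EqWindow-sym (EqWindow-tail eq)) (EqWindow-init eq′))

  ⊆-distinct-length : m ≤ length w → length v ≤ length w
  ⊆-distinct-length m≤|w| with suc m ≤? length v
  ... | no short = ≤-trans (≤-pred (≰⇒> short)) m≤|w|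
  ... | yes long with j , s≤j , j-fits , _ ← track (length v ∸ suc m) (≤-reflexive (m∸n+n≡m long)) = begin
    length v                  ≡⟨ m∸n+n≡m long ⟨
    length v ∸ suc m + suc m  ≤⟨ +-monoˡ-≤ (suc m) s≤j ⟩
    j + suc m                 ≤⟨ j-fits ⟩
    length w                  ∎
    where open ≤-Reasoning

words : ∀ {m} → ℕ → List (Word m)
words zero = [] ∷ []
words (suc n) = cartesianProductWith _∷_ (allFin _) (words n)

∈-words : ∀ {m} (u : Word m) → u ∈ words (length u)
∈-words [] = here refl
∈-words (x ∷ u) = ∈-cartesianProductWith⁺ _∷_ (∈-allFin x) (∈-words u)

words-length : ∀ {m} n {u : Word m} → u ∈ words n → length u ≡ n
words-length zero (here refl) = refl
words-length (suc n) u∈ with _ , u′ , _ , u′∈ , refl ← ∈-cartesianProductWith⁻ _∷_ (allFin _) (words n) u∈ =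
  cong suc (words-length n u′∈)

pattern⇒∋zero : ∀ {u : Word (suc q)} → IsPattern u → zero ∈ u
pattern⇒∋zero (_ , k , 1≤k , letters , _) with letters 0 1≤k
... | zero , _ , 0∈u = 0∈u

∋zero⇒pattern : ∀ {u : Word 2} → zero ∈ u → IsPattern u
∋zero⇒pattern {u} 0∈u with suc zero ∈? u
... | yes 1∈u = ∈-length 0∈u , 2 , s≤s z≤n
                , (λ { 0 _ → zero , refl , 0∈u ; 1 _ → suc zero , refl , 1∈u ; (suc (suc _)) (s≤s (s≤s ())) })
                , All.tabulate (λ {a} _ → toℕ<n a)
... | no 1∉u = ∈-length 0∈u , 1 , s≤s z≤n , (λ { 0 _ → zero , refl , 0∈u ; (suc _) (s≤s ()) })
                , All.tabulate (λ { {zero} _ → s≤s z≤n ; {suc zero} 1∈u → contradiction 1∈u 1∉u })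

∉zero⇒ones : ∀ {u : Word 2} → zero ∉ u → ∀ {r} → r < length u → at u r ≡ suc zero
∉zero⇒ones {u} 0∉u r<|u| = other-letter (at u _) (at-∈ u r<|u|)
  where
  other-letter : ∀ a → a ∈ u → a ≡ suc zero
  other-letter zero 0∈u = contradiction 0∈u 0∉u
  other-letter (suc zero) _ = refl

module Attained {m : ℕ} (w : Word 2) (distinct : DistinctWindows m w) (m≤|w| : m ≤ length w) where

  Missing : Word 2 → Set
  Missing u = zero ∈ u × ¬ Subword u w

  missing? : ∀ u → Dec (Missing u)
  missing? u = zero ∈? u ×-dec ¬? (subword? u w)

  S : List (Word 2)
  S = filter missing? (words (suc m))

  S-patterns : PatternSet (suc m) S
  S-patterns = All.tabulate λ p∈S →
    let p∈words , 0∈p , _ = ∈-filter⁻ missing? {xs = words (suc m)} p∈S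
    in ∋zero⇒pattern 0∈p , words-length (suc m) p∈words

  w-free : Free S w
  w-free p p∈S = proj₂ (proj₂ (∈-filter⁻ missing? {xs = words (suc m)} p∈S))

  w-npattern : NPatternWord (suc m) w
  w-npattern u u⊑w |u| with zero ∈? u
  ... | yes 0∈u = ∋zero⇒pattern 0∈u
  ... | no 0∉u with i , i-fits , u≡w ← subword-at u⊑w =
    contradiction (distinct i (suc i) (≤-trans (+-monoʳ-≤ i (n≤1+n m)) fits) (subst (_≤ length w) (+-suc i m) fits) ones)
                  (1+n≢n ∘ sym)
    where
    fits : i + suc m ≤ length w
    fits = subst (λ l → i + l ≤ length w) |u| i-fits
    one : ∀ {r} → r < suc m → at w (i + r) ≡ suc zero
    one {r} r≤m = trans (sym (agree u≡w r r<|u|)) (∉zero⇒ones 0∉u r<|u|)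
      where
      r<|u| : r < length u
      r<|u| = subst (r <_) (sym |u|) r≤m
    ones : EqWindow m (at w) i (at w) (suc i)
    ones = eqWindow λ r r<m → trans (one (m<n⇒m<1+n r<m)) (sym (trans (cong (at w) (sym (+-suc i r))) (one (s≤s r<m))))

  S-unavoidable : Unavoidable (suc m) S
  S-unavoidable = suc (length w) , λ v v-pattern v-free →
    s≤s (⊆-distinct-length distinct (v⊆w v v-pattern v-free) m≤|w|)
    where
    v⊆w : ∀ v → NPatternWord (suc m) v → Free S v → v ⊆[ suc m ] w
    v⊆w v v-pattern v-free u u⊑v |u| with subword? u w
    ... | yes u⊑w = u⊑w
    ... | no u⋢w =
      contradiction u⊑v (v-free u (∈-filter⁺ missing? u∈words (pattern⇒∋zero (v-pattern u u⊑v |u|) , u⋢w)))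
      where
      u∈words : u ∈ words (suc m)
      u∈words = subst (λ n → u ∈ words n) |u| (∈-words u)


open Injection (↔⇒↣ (↔-sym 2↔Bool)) using () renaming (to to letter; injective to letter-injective)

1+L≡2^m+m : ∀ m → suc (2 ^ m + suc m ∸ 2) ≡ 2 ^ m + m
1+L≡2^m+m m with 2 ^ m | m^n>0 2 m
... | suc t | _ = cong (λ z → suc (z ∸ 1)) (+-suc t m)

de-Bruijn-word : ∀ m → ∃ λ (w : Word 2) → length w ≡ 2 ^ m + suc m ∸ 2 × DistinctWindows m w
de-Bruijn-word m with f , C ← de-Bruijn-cycle m = applyUpTo (letter ∘ f) L , |w| , distinct
  where
  L = 2 ^ m + suc m ∸ 2
  |w| = length-applyUpTo (letter ∘ f) L
  in-period : ∀ {i} → i + m ≤ length (applyUpTo (letter ∘ f) L) → i < 2 ^ m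
  in-period {i} fits = +-cancelʳ-< m i (2 ^ m) (subst (i + m <_) (1+L≡2^m+m m) (s≤s (subst (i + m ≤_) |w| fits)))
  distinct : DistinctWindows m (applyUpTo (letter ∘ f) L)
  distinct i j i-fits j-fits eq = DeBruijnCycle.distinct C i j (in-period i-fits) (in-period j-fits)
    (eqWindow λ r r<m → letter-injective (begin
      letter (f (i + r))                    ≡⟨ at-applyUpTo (letter ∘ f) (inside i-fits r<m) ⟨
      at (applyUpTo (letter ∘ f) L) (i + r) ≡⟨ agree eq r r<m ⟩
      at (applyUpTo (letter ∘ f) L) (j + r) ≡⟨ at-applyUpTo (letter ∘ f) (inside j-fits r<m) ⟩
      letter (f (j + r))                    ∎))
    where
    open ≡-Reasoning
    inside : ∀ {i r} → i + m ≤ length (applyUpTo (letter ∘ f) L) → r < m → i + r < L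
    inside {i} fits r<m = <-≤-trans (+-monoʳ-< i r<m) (subst (i + m ≤_) |w| fits)

attained : ∀ m → Σ (List (Word 2)) λ S → PatternSet (suc m) S × Unavoidable (suc m) S ×
             Σ (Word 2) λ w → NPatternWord (suc m) w × Free S w × length w ≡ 2 ^ m + suc m ∸ 2
attained m with w , |w| , distinct ← de-Bruijn-word m = S , S-patterns , S-unavoidable , w , w-npattern , w-free , |w|
  where
  m≤|w| : m ≤ length w
  m≤|w| = ≤-pred (subst (suc m ≤_) (sym (trans (cong suc |w|) (1+L≡2^m+m m))) (+-monoˡ-≤ m (m^n>0 2 m)))
  open Attained w distinct m≤|w|

theorem5 : (n : ℕ) → 1 ≤ n → LpEquals n 2 ((2 ^ (n ∸ 1) + n) ∸ 2)
theorem5 (suc m) _ = upper , attained m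
  where
  upper : (S : List (Word 2)) → PatternSet (suc m) S → Unavoidable (suc m) S →
          (w : Word 2) → NPatternWord (suc m) w → Free S w → length w ≤ 2 ^ m + suc m ∸ 2
  upper S S-patterns S-unavoidable w w-pattern w-free =
    ≤-pred (subst (length w <_) (sym (1+L≡2^m+m m)) (unavoidable-bound S-patterns S-unavoidable w w-pattern w-free))
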